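{- Let $R, S \in \mathfrak{T}_a \cap \mathfrak{D}_r$ with $R^* = R_\times$ and $S^* = S_\times$. If $\#\mathcal{H}(G,R) \le \#\mathcal{H}(G,S)$ for every $G \in \mathfrak{T}_a$, then $$\#\mathcal{S}(G,R) \le \#\mathcal{S}(G,S) \quad \text{for all } G \in \mathfrak{T}_a \text{ with } \mathcal{S}(G,S) \neq \emptyset.$$
   Context: A digraph $G=(V(G),A(G))$ has a finite nonempty vertex set $V(G)$ and an arc set $A(G)\subseteq V(G)\times V(G)$; $vw$ denotes the pair $(v,w)$. An arc $vw$ is proper if $v\ne w$, otherwise it is a loop. $G^*$ denotes $G$ with all loops removed. $\mathfrak{D}_r$ is the class of reflexive digraphs, and $\mathfrak{T}_a$ is the class of digraphs $G$ such that $G^*$ is acyclic (contains no closed directed walk). A homomorphism $\xi:G\to H$ is a map $V(G)\to V(H)$ with $\xi(v)\xi(w)\in A(H)$ for all $vw\in A(G)$; $\mathcal{H}(G,H)$ is the set of homomorphisms, and $\mathcal{S}(G,H)=\mathcal{H}(G,H)\cap\mathcal{H}(G^*,H^*)$ is the set of strict homomorphisms (those mapping proper arcs to proper arcs). For $G\in\mathfrak{T}_a$, $G_\times$ is the digraph with vertex set $V(G)$ whose arcs are those $vw\in A(G^*)$ for which there is no directed walk of length $\ge 2$ in $G^*$ from $v$ to $w$ (the loopless transitive reduction of $G$). -}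

module Defs where

open import Data.Nat using (ℕ; zero; suc; _≤_)
open import Data.Fin using (Fin; zero; suc)
open import Data.Fin.Properties using (all?) renaming (_≟_ to _≟F_)
open import Data.Bool using (Bool; true; false)
open import Data.Bool.Properties using () renaming (_≟_ to _≟B_)
open import Data.List using (List; []; _∷_; [_]; map; concatMap; filter; length)
open import Data.List.Membership.Propositional using (_∈_)
open import Data.Product using (_×_; _,_)
open import Data.Empty using (⊥)
open import Relation.Nullary using (¬_; Dec; yes; no)
open import Relation.Nullary.Decidable using (_→-dec_; _×-dec_; ¬?)
open import Relation.Binary.PropositionalEquality using (_≡_; _≢_)
open import Function.Bundles using (_⇔_)

-- A (finite, nonempty) digraph: vertex set Fin (suc size), arc set given by
-- a Boolean adjacency function (arcs may be loops).
record Digraph : Set where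
  field
    size : ℕ
    arc  : Fin (suc size) → Fin (suc size) → Bool

open Digraph public

V : Digraph → Set
V G = Fin (suc (size G))

Arc : (G : Digraph) → V G → V G → Set
Arc G v w = arc G v w ≡ true

ArcStar : (G : Digraph) → V G → V G → Set
ArcStar G v w = Arc G v w × v ≢ w

data Walk (G : Digraph) : V G → V G → ℕ → Set where
  here : ∀ {v} → Walk G v v 0
  step : ∀ {u v w k} → ArcStar G u v → Walk G v w k → Walk G u w (suc k)

Reflexive : Digraph → Set
Reflexive G = ∀ v → Arc G v v

Acyclic : Digraph → Set
Acyclic G = ∀ v k → ¬ Walk G v v (suc k)

ArcTimes : (G : Digraph) → V G → V G → Set
ArcTimes G v w = ArcStar G v w × (∀ k → ¬ Walk G v w (suc (suc k)))

StarIsTimes : Digraph → Set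
StarIsTimes G = ∀ v w → ArcStar G v w ⇔ ArcTimes G v w

IsHom : (G H : Digraph) → (V G → V H) → Set
IsHom G H f = ∀ v w → Arc G v w → Arc H (f v) (f w)

IsHomStar : (G H : Digraph) → (V G → V H) → Set
IsHomStar G H f = ∀ v w → ArcStar G v w → ArcStar H (f v) (f w)

IsStrict : (G H : Digraph) → (V G → V H) → Set
IsStrict G H f = IsHom G H f × IsHomStar G H f

isHom? : (G H : Digraph) → (f : V G → V H) → Dec (IsHom G H f)
isHom? G H f = all? λ v → all? λ w →
  (arc G v w ≟B true) →-dec (arc H (f v) (f w) ≟B true)

isStrict? : (G H : Digraph) → (f : V G → V H) → Dec (IsStrict G H f)
isStrict? G H f = isHom? G H f ×-dec (all? λ v → all? λ w →
  ((arc G v w ≟B true) ×-dec ¬? (v ≟F w)) →-dec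
  ((arc H (f v) (f w) ≟B true) ×-dec ¬? (f v ≟F f w)))

-- Enumeration of all maps Fin n → Fin m (each exactly once, up to pointwise equality)
extend : ∀ {n m} → Fin m → (Fin n → Fin m) → Fin (suc n) → Fin m
extend i f zero    = i
extend i f (suc j) = f j

allFin' : (m : ℕ) → List (Fin m)
allFin' zero    = []
allFin' (suc m) = zero ∷ map suc (allFin' m)

allMaps : (n m : ℕ) → List (Fin n → Fin m)
allMaps zero    m = [ (λ ()) ]
allMaps (suc n) m = concatMap (λ f → map (λ i → extend i f) (allFin' m)) (allMaps n m)

#Hom : Digraph → Digraph → ℕ
#Hom G H = length (filter (isHom? G H) (allMaps (suc (size G)) (suc (size H))))

#Strict : Digraph → Digraph → ℕ
#Strict G H = length (filter (isStrict? G H) (allMaps (suc (size G)) (suc (size H))))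

module Submission where

-- Fix G acyclic and n ∈ ℕ, list the proper arcs
-- a₁ … a_m of G and let G⁽ⁿ⁾ be G with n new vertices x attached to every
-- proper arc vw by two arcs v → x → w.  Then G⁽ⁿ⁾ is again acyclic, and a
-- homomorphism G⁽ⁿ⁾ → T is a homomorphism h : G → T together with, for every
-- new vertex on vw, a vertex of T between h v and h w; hence
--     #𝓗(G⁽ⁿ⁾,T) = Σ_{h ∈ 𝓗(G,T)} (Π_i #Middle_T(h aᵢ))ⁿ,
-- where #Middle_T(a,b) counts the x with a → x → b in T.
-- For reflexive R a strict h has #Middle ≥ 2 on every arc (x = h v, h w), so
-- #𝓗(G⁽ⁿ⁾,R) ≥ #𝓢(G,R)·X with X = (2^m)ⁿ.  For S acyclic with S* = S_×,
-- #Middle ≤ 2 on every arc and ≤ 1 on an arc collapsed by a non-strict h, so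
-- 2ⁿ·#𝓗(G⁽ⁿ⁾,S) ≤ #𝓢(G,S)·2ⁿ·X + #𝓗(G,S)·X.  Choosing n = #𝓗(G,S) < 2ⁿ
-- and applying the hypothesis to G⁽ⁿ⁾ squeezes #𝓢(G,R) ≤ #𝓢(G,S).

open import Defs
open import Data.Nat using (ℕ; zero; suc; _+_; _*_; _^_; _≤_; _<_; z≤n; s≤s; s≤s⁻¹)
open import Data.Nat.Properties
open import Data.Nat.Solver using (module +-*-Solver)
open import Data.Fin using (Fin; zero; suc; splitAt; join; _↑ˡ_; _↑ʳ_)
open import Data.Fin.Properties using (all?; ¬∀⟶∃¬; splitAt-↑ˡ; splitAt-↑ʳ; join-splitAt)
  renaming (_≟_ to _≟F_; suc-injective to sucF-injective)
open import Data.Bool using (Bool; true; false)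
open import Data.Bool.Properties using () renaming (_≟_ to _≟B_)
open import Data.List using (List; []; _∷_; map; concatMap; filter; length; _++_; cartesianProduct; lookup)
open import Data.List.Membership.Propositional using (_∈_)
open import Data.List.Membership.Propositional.Properties
  using (∈-map⁺; ∈-filter⁺; ∈-filter⁻; ∈-lookup; ∈-cartesianProduct⁺)
open import Data.List.Relation.Unary.Any using (here; there; index)
open import Data.List.Relation.Unary.Any.Properties using (lookup-index)
open import Data.Sum using (_⊎_; inj₁; inj₂; [_,_]′)
open import Data.Product using (_×_; _,_; proj₁; proj₂; Σ; ∃; ∃₂)
open import Data.Unit using (⊤; tt)
open import Data.Empty using (⊥; ⊥-elim)
open import Relation.Nullary using (¬_; Dec; yes; no; does)
open import Relation.Nullary.Decidable using (_→-dec_; _×-dec_; ¬?)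
open import Relation.Binary.PropositionalEquality
open import Function.Bundles using (Equivalence)
open +-*-Solver

Σl : ∀ {A : Set} → List A → (A → ℕ) → ℕ
Σl []       f = 0
Σl (x ∷ xs) f = f x + Σl xs f

Σl-cong : ∀ {A : Set} (xs : List A) {f g : A → ℕ} → (∀ x → f x ≡ g x) → Σl xs f ≡ Σl xs g
Σl-cong []       e = refl
Σl-cong (x ∷ xs) e = cong₂ _+_ (e x) (Σl-cong xs e)

Σl-mono : ∀ {A : Set} (xs : List A) {f g : A → ℕ} → (∀ x → f x ≤ g x) → Σl xs f ≤ Σl xs g
Σl-mono []       e = z≤n
Σl-mono (x ∷ xs) e = +-mono-≤ (e x) (Σl-mono xs e)

Σl-zero : ∀ {A : Set} (xs : List A) {f : A → ℕ} → (∀ x → f x ≡ 0) → Σl xs f ≡ 0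
Σl-zero []       e = refl
Σl-zero (x ∷ xs) e = cong₂ _+_ (e x) (Σl-zero xs e)

Σl-map : ∀ {A B : Set} (g : A → B) (xs : List A) (f : B → ℕ) →
  Σl (map g xs) f ≡ Σl xs (λ x → f (g x))
Σl-map g []       f = refl
Σl-map g (x ∷ xs) f = cong (f (g x) +_) (Σl-map g xs f)

Σl-++ : ∀ {A : Set} (xs ys : List A) (f : A → ℕ) → Σl (xs ++ ys) f ≡ Σl xs f + Σl ys f
Σl-++ []       ys f = refl
Σl-++ (x ∷ xs) ys f = trans (cong (f x +_) (Σl-++ xs ys f)) (sym (+-assoc (f x) _ _))

Σl-concatMap : ∀ {A B : Set} (g : A → List B) (xs : List A) (f : B → ℕ) →
  Σl (concatMap g xs) f ≡ Σl xs (λ x → Σl (g x) f)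
Σl-concatMap g []       f = refl
Σl-concatMap g (x ∷ xs) f =
  trans (Σl-++ (g x) (concatMap g xs) f) (cong (Σl (g x) f +_) (Σl-concatMap g xs f))

Σl-+ : ∀ {A : Set} (xs : List A) (f g : A → ℕ) →
  Σl xs (λ x → f x + g x) ≡ Σl xs f + Σl xs g
Σl-+ []       f g = refl
Σl-+ (x ∷ xs) f g rewrite Σl-+ xs f g =
  solve 4 (λ a b c d → (a :+ b) :+ (c :+ d) := (a :+ c) :+ (b :+ d)) refl
    (f x) (g x) (Σl xs f) (Σl xs g)

Σl-*ˡ : ∀ {A : Set} (xs : List A) (c : ℕ) (f : A → ℕ) → Σl xs (λ x → c * f x) ≡ c * Σl xs f
Σl-*ˡ []       c f = sym (*-zeroʳ c)
Σl-*ˡ (x ∷ xs) c f rewrite Σl-*ˡ xs c f = sym (*-distribˡ-+ c (f x) (Σl xs f))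

Σl-*ʳ : ∀ {A : Set} (xs : List A) (c : ℕ) (f : A → ℕ) → Σl xs (λ x → f x * c) ≡ Σl xs f * c
Σl-*ʳ xs c f = trans (Σl-cong xs (λ x → *-comm (f x) c)) (trans (Σl-*ˡ xs c f) (*-comm c _))

Σl-swap : ∀ {A B : Set} (xs : List A) (ys : List B) (f : A → B → ℕ) →
  Σl xs (λ x → Σl ys (f x)) ≡ Σl ys (λ y → Σl xs (λ x → f x y))
Σl-swap []       ys f = sym (Σl-zero ys (λ _ → refl))
Σl-swap (x ∷ xs) ys f rewrite Σl-swap xs ys f = sym (Σl-+ ys (f x) (λ y → Σl xs (λ x → f x y)))

ind : ∀ {P : Set} → Dec P → ℕ
ind (yes _) = 1
ind (no _)  = 0

ind-yes : ∀ {P : Set} (d : Dec P) → P → ind d ≡ 1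
ind-yes (yes _) p = refl
ind-yes (no ¬p) p = ⊥-elim (¬p p)

ind-no : ∀ {P : Set} (d : Dec P) → ¬ P → ind d ≡ 0
ind-no (yes p) ¬p = ⊥-elim (¬p p)
ind-no (no _)  ¬p = refl

ind-cong : ∀ {P Q : Set} → (P → Q) → (Q → P) → (d : Dec P) (e : Dec Q) → ind d ≡ ind e
ind-cong f g (yes p) e = sym (ind-yes e (f p))
ind-cong f g (no ¬p) e = sym (ind-no e (λ q → ¬p (g q)))

length-filter : ∀ {A : Set} {P : A → Set} (P? : ∀ x → Dec (P x)) (xs : List A) →
  length (filter P? xs) ≡ Σl xs (λ x → ind (P? x))
length-filter P? []       = refl
length-filter P? (x ∷ xs) with P? x
... | yes _ = cong suc (length-filter P? xs)
... | no _  = length-filter P? xs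

Πf : ∀ m → (Fin m → ℕ) → ℕ
Πf zero    f = 1
Πf (suc m) f = f zero * Πf m (λ i → f (suc i))

Πf-cong : ∀ m {f g : Fin m → ℕ} → (∀ i → f i ≡ g i) → Πf m f ≡ Πf m g
Πf-cong zero    e = refl
Πf-cong (suc m) e = cong₂ _*_ (e zero) (Πf-cong m (λ i → e (suc i)))

Πf-split : ∀ a b (f : Fin (a + b) → ℕ) →
  Πf (a + b) f ≡ Πf a (λ i → f (i ↑ˡ b)) * Πf b (λ j → f (a ↑ʳ j))
Πf-split zero    b f = sym (+-identityʳ _)
Πf-split (suc a) b f rewrite Πf-split a b (λ i → f (suc i)) =
  sym (*-assoc (f zero) (Πf a (λ i → f (suc (i ↑ˡ b)))) _)

Πf-one : ∀ m {f : Fin m → ℕ} → (∀ i → f i ≡ 1) → Πf m f ≡ 1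
Πf-one zero    e = refl
Πf-one (suc m) e rewrite e zero | Πf-one m (λ i → e (suc i)) = refl

Πf-zero : ∀ m {f : Fin m → ℕ} (i : Fin m) → f i ≡ 0 → Πf m f ≡ 0
Πf-zero (suc m) {f} zero    e rewrite e = refl
Πf-zero (suc m) {f} (suc i) e rewrite Πf-zero m {λ i → f (suc i)} i e = *-zeroʳ (f zero)

Πf-ind : ∀ c {Q : Fin c → Set} (d : ∀ j → Dec (Q j)) {P : Set} (e : Dec P) →
  (P → ∀ j → Q j) → ((∀ j → Q j) → P) → ind e ≡ Πf c (λ j → ind (d j))
Πf-ind c d (yes p) f g = sym (Πf-one c (λ j → ind-yes (d j) (f p j)))
Πf-ind c {Q} d (no ¬p) f g with ¬∀⟶∃¬ c Q d (λ q → ¬p (g q))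
... | j , ¬q = sym (Πf-zero c j (ind-no (d j) ¬q))

Πf-≥2 : ∀ m {f : Fin m → ℕ} → (∀ i → 2 ≤ f i) → 2 ^ m ≤ Πf m f
Πf-≥2 zero    e = ≤-refl
Πf-≥2 (suc m) e = *-mono-≤ (e zero) (Πf-≥2 m (λ i → e (suc i)))

Πf-≤2 : ∀ m {f : Fin m → ℕ} → (∀ i → f i ≤ 2) → Πf m f ≤ 2 ^ m
Πf-≤2 zero    e = ≤-refl
Πf-≤2 (suc m) e = *-mono-≤ (e zero) (Πf-≤2 m (λ i → e (suc i)))

Πf-≤2-defect : ∀ m {f : Fin m → ℕ} → (∀ i → f i ≤ 2) → (i₀ : Fin m) → f i₀ ≤ 1 →
  2 * Πf m f ≤ 2 ^ m
Πf-≤2-defect (suc m) {f} e zero le =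
  *-monoʳ-≤ 2 (≤-trans (*-mono-≤ le (Πf-≤2 m (λ i → e (suc i)))) (≤-reflexive (*-identityˡ _)))
Πf-≤2-defect (suc m) {f} e (suc i₀) le = begin
    2 * (f zero * P)  ≡⟨ solve 2 (λ a p → con 2 :* (a :* p) := a :* (con 2 :* p)) refl (f zero) P ⟩
    f zero * (2 * P)  ≤⟨ *-mono-≤ (e zero) (Πf-≤2-defect m (λ i → e (suc i)) i₀ le) ⟩
    2 * 2 ^ m         ∎
  where
  open ≤-Reasoning
  P = Πf m (λ i → f (suc i))

-- copyOf n j: the block of j in Fin (n * m) = n consecutive copies of Fin m.
copyOf : ∀ n {m} → Fin (n * m) → Fin m
copyOf (suc n) {m} j = [ (λ i → i) , copyOf n ]′ (splitAt m j)

Πf-copies : ∀ n m (K : Fin m → ℕ) → Πf (n * m) (λ j → K (copyOf n j)) ≡ Πf m K ^ n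
Πf-copies zero    m K = refl
Πf-copies (suc n) m K = begin
    Πf (m + n * m) (λ j → K (copyOf (suc n) j))
      ≡⟨ Πf-split m (n * m) _ ⟩
    Πf m (λ i → K (copyOf (suc n) (i ↑ˡ (n * m)))) * Πf (n * m) (λ j → K (copyOf (suc n) (m ↑ʳ j)))
      ≡⟨ cong₂ _*_ (Πf-cong m (λ i → cong block (splitAt-↑ˡ m i (n * m))))
                   (Πf-cong (n * m) (λ j → cong block (splitAt-↑ʳ m (n * m) j))) ⟩
    Πf m K * Πf (n * m) (λ j → K (copyOf n j))
      ≡⟨ cong (Πf m K *_) (Πf-copies n m K) ⟩
    Πf m K * Πf m K ^ n ∎
  where
  open ≡-Reasoning
  block : Fin m ⊎ Fin (n * m) → ℕ
  block z = K ([ (λ i → i) , copyOf n ]′ z)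

glue : ∀ {k c B : ℕ} → (Fin k → Fin B) → (Fin c → Fin B) → Fin (k + c) → Fin B
glue {k} h t a = [ h , t ]′ (splitAt k a)

-- Weights on maps that respect pointwise equality (there is no funext).
Respects : ∀ {a B} → ((Fin a → Fin B) → ℕ) → Set
Respects {a} {B} w = ∀ f g → (∀ x → f x ≡ g x) → w f ≡ w g

extend-glue : ∀ {k c B} (i : Fin B) (h : Fin k → Fin B) (t : Fin c → Fin B) (a : Fin (suc k + c)) →
  extend i (glue h t) a ≡ glue (extend i h) t a
extend-glue i h t zero = refl
extend-glue {k} i h t (suc a) with splitAt k a
... | inj₁ x = refl
... | inj₂ y = refl

Σ-maps-split : ∀ k c B (w : (Fin (k + c) → Fin B) → ℕ) → Respects w →
  Σl (allMaps (k + c) B) w ≡ Σl (allMaps c B) (λ t → Σl (allMaps k B) (λ h → w (glue h t)))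
Σ-maps-split zero    c B w r = Σl-cong (allMaps c B) (λ t → sym (+-identityʳ _))
Σ-maps-split (suc k) c B w r = begin
    Σl (concatMap (λ f → map (λ i → extend i f) (allFin' B)) (allMaps (k + c) B)) w
      ≡⟨ Σl-concatMap _ (allMaps (k + c) B) w ⟩
    Σl (allMaps (k + c) B) (λ f → Σl (map (λ i → extend i f) (allFin' B)) w)
      ≡⟨ Σl-cong (allMaps (k + c) B) (λ f → Σl-map _ (allFin' B) w) ⟩
    Σl (allMaps (k + c) B) w'
      ≡⟨ Σ-maps-split k c B w' r' ⟩
    Σl (allMaps c B) (λ t → Σl (allMaps k B) (λ h → w' (glue h t)))
      ≡⟨ Σl-cong (allMaps c B) (λ t → Σl-cong (allMaps k B) (λ h →
           Σl-cong (allFin' B) (λ i → r _ _ (extend-glue i h t)))) ⟩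
    Σl (allMaps c B) (λ t → Σl (allMaps k B) (λ h → Σl (allFin' B) (λ i → w (glue (extend i h) t))))
      ≡⟨ Σl-cong (allMaps c B) (λ t → sym (trans (Σl-concatMap _ (allMaps k B) _)
           (Σl-cong (allMaps k B) (λ h → Σl-map _ (allFin' B) _)))) ⟩
    Σl (allMaps c B) (λ t → Σl (allMaps (suc k) B) (λ h → w (glue h t))) ∎
  where
  open ≡-Reasoning
  w' : (Fin (k + c) → Fin B) → ℕ
  w' f = Σl (allFin' B) (λ i → w (extend i f))
  r' : Respects w'
  r' f g e = Σl-cong (allFin' B) (λ i → r _ _ (λ { zero → refl ; (suc a) → e a }))

Σ-maps-Π : ∀ c B (w : Fin c → Fin B → ℕ) →
  Σl (allMaps c B) (λ t → Πf c (λ j → w j (t j))) ≡ Πf c (λ j → Σl (allFin' B) (w j))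
Σ-maps-Π zero    B w = refl
Σ-maps-Π (suc c) B w = begin
    Σl (concatMap (λ f → map (λ i → extend i f) (allFin' B)) (allMaps c B)) F
      ≡⟨ Σl-concatMap _ (allMaps c B) F ⟩
    Σl (allMaps c B) (λ f → Σl (map (λ i → extend i f) (allFin' B)) F)
      ≡⟨ Σl-cong (allMaps c B) (λ f → Σl-map _ (allFin' B) F) ⟩
    Σl (allMaps c B) (λ f → Σl (allFin' B) (λ i → w zero i * rest f))
      ≡⟨ Σl-cong (allMaps c B) (λ f → Σl-*ʳ (allFin' B) _ (w zero)) ⟩
    Σl (allMaps c B) (λ f → Σl (allFin' B) (w zero) * rest f)
      ≡⟨ Σl-*ˡ (allMaps c B) (Σl (allFin' B) (w zero)) rest ⟩
    Σl (allFin' B) (w zero) * Σl (allMaps c B) rest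
      ≡⟨ cong (Σl (allFin' B) (w zero) *_) (Σ-maps-Π c B (λ j → w (suc j))) ⟩
    Σl (allFin' B) (w zero) * Πf c (λ j → Σl (allFin' B) (w (suc j))) ∎
  where
  open ≡-Reasoning
  F : (Fin (suc c) → Fin B) → ℕ
  F t = Πf (suc c) (λ j → w j (t j))
  rest : (Fin c → Fin B) → ℕ
  rest f = Πf c (λ j → w (suc j) (f j))

count : ∀ {B} {P : Fin B → Set} → (∀ x → Dec (P x)) → ℕ
count {B} P? = Σl (allFin' B) (λ x → ind (P? x))

Σf-suc : ∀ m (f : Fin (suc m) → ℕ) → Σl (allFin' (suc m)) f ≡ f zero + Σl (allFin' m) (λ x → f (suc x))
Σf-suc m f = cong (f zero +_) (Σl-map suc (allFin' m) f)

Σf-≥1 : ∀ m (f : Fin m → ℕ) a → f a ≤ Σl (allFin' m) f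
Σf-≥1 (suc m) f zero    rewrite Σf-suc m f = m≤m+n _ _
Σf-≥1 (suc m) f (suc a) rewrite Σf-suc m f = ≤-trans (Σf-≥1 m (λ x → f (suc x)) a) (m≤n+m _ _)

Σf-≥2 : ∀ m (f : Fin m → ℕ) a b → a ≢ b → f a + f b ≤ Σl (allFin' m) f
Σf-≥2 (suc m) f zero    zero    ne = ⊥-elim (ne refl)
Σf-≥2 (suc m) f zero    (suc b) ne rewrite Σf-suc m f =
  +-monoʳ-≤ (f zero) (Σf-≥1 m (λ x → f (suc x)) b)
Σf-≥2 (suc m) f (suc a) zero    ne rewrite Σf-suc m f | +-comm (f (suc a)) (f zero) =
  +-monoʳ-≤ (f zero) (Σf-≥1 m (λ x → f (suc x)) a)
Σf-≥2 (suc m) f (suc a) (suc b) ne rewrite Σf-suc m f =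
  ≤-trans (Σf-≥2 m (λ x → f (suc x)) a b (λ e → ne (cong suc e))) (m≤n+m _ _)

count-≡ : ∀ m (a : Fin m) → count (λ x → x ≟F a) ≡ 1
count-≡ (suc m) zero rewrite Σf-suc m (λ x → ind (x ≟F zero)) =
  cong suc (Σl-zero (allFin' m) (λ x → ind-no (suc x ≟F zero) (λ ())))
count-≡ (suc m) (suc a) rewrite Σf-suc m (λ x → ind (x ≟F suc a)) =
  trans (cong₂ _+_ (ind-no (zero ≟F suc a) (λ ()))
    (Σl-cong (allFin' m) (λ x → ind-cong sucF-injective (cong suc) (suc x ≟F suc a) (x ≟F a))))
    (count-≡ m a)

count-≥2 : ∀ {B} {P : Fin B → Set} (P? : ∀ x → Dec (P x)) {a b} → a ≢ b → P a → P b → 2 ≤ count P?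
count-≥2 {B} P? {a} {b} a≢b pa pb =
  ≤-trans (≤-reflexive (sym (cong₂ _+_ (ind-yes (P? a) pa) (ind-yes (P? b) pb))))
          (Σf-≥2 B (λ x → ind (P? x)) a b a≢b)

count-≤1 : ∀ {B} {P : Fin B → Set} (P? : ∀ x → Dec (P x)) a → (∀ x → P x → x ≡ a) → count P? ≤ 1
count-≤1 {B} P? a only = ≤-trans (Σl-mono (allFin' B) pointwise) (≤-reflexive (count-≡ B a))
  where
  pointwise : ∀ x → ind (P? x) ≤ ind (x ≟F a)
  pointwise x with P? x
  ... | no _   = z≤n
  ... | yes px = ≤-reflexive (sym (ind-yes (x ≟F a) (only x px)))

count-≤2 : ∀ {B} {P : Fin B → Set} (P? : ∀ x → Dec (P x)) a b → (∀ x → P x → x ≡ a ⊎ x ≡ b) →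
  count P? ≤ 2
count-≤2 {B} P? a b only = ≤-trans (Σl-mono (allFin' B) pointwise) (≤-reflexive two)
  where
  pointwise : ∀ x → ind (P? x) ≤ ind (x ≟F a) + ind (x ≟F b)
  pointwise x with P? x
  ... | no _ = z≤n
  ... | yes px with only x px
  ... | inj₁ e = ≤-trans (≤-reflexive (sym (ind-yes (x ≟F a) e))) (m≤m+n _ _)
  ... | inj₂ e = ≤-trans (≤-reflexive (sym (ind-yes (x ≟F b) e))) (m≤n+m _ _)
  two : Σl (allFin' B) (λ x → ind (x ≟F a) + ind (x ≟F b)) ≡ 2
  two = trans (Σl-+ (allFin' B) _ _) (cong₂ _+_ (count-≡ B a) (count-≡ B b))

-- Arithmetic: n < 2ⁿ makes the non-strict contribution negligible.

n<2^n : ∀ n → n < 2 ^ n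
n<2^n zero    = s≤s z≤n
n<2^n (suc n) = +-mono-≤ (m^n>0 2 n) (≤-trans (n<2^n n) (m≤m+n _ 0))

*-^-distrib : ∀ a b n → (a * b) ^ n ≡ a ^ n * b ^ n
*-^-distrib a b zero    = refl
*-^-distrib a b (suc n) rewrite *-^-distrib a b n =
  solve 4 (λ a b x y → (a :* b) :* (x :* y) := (a :* x) :* (b :* y)) refl a b (a ^ n) (b ^ n)

squeeze : ∀ {a b h N X H₁ H₂} → a * X ≤ H₁ → H₁ ≤ H₂ → N * H₂ ≤ b * (N * X) + h * X →
  h < N → 1 ≤ X → a ≤ b
squeeze {a} {b} {h} {N} {X} {H₁} {H₂} lower H₁≤H₂ upper h<N X≥1 =
  s≤s⁻¹ (*-cancelˡ-< (N * X) a (suc b) chain)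
  where
  open ≤-Reasoning
  hX<NX : h * X < N * X
  hX<NX = ≤-trans (+-monoˡ-≤ (h * X) X≥1) (*-monoˡ-≤ X h<N)
  chain : (N * X) * a < (N * X) * suc b
  chain = begin-strict
    (N * X) * a           ≡⟨ solve 3 (λ n a x → (n :* x) :* a := n :* (a :* x)) refl N a X ⟩
    N * (a * X)           ≤⟨ *-monoʳ-≤ N (≤-trans lower H₁≤H₂) ⟩
    N * H₂                ≤⟨ upper ⟩
    b * (N * X) + h * X   <⟨ +-monoʳ-< (b * (N * X)) hX<NX ⟩
    b * (N * X) + N * X   ≡⟨ solve 3 (λ n b x → b :* (n :* x) :+ n :* x := (n :* x) :* (con 1 :+ b)) refl N b X ⟩
    (N * X) * suc b       ∎

∈-allFin' : ∀ m (x : Fin m) → x ∈ allFin' m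
∈-allFin' (suc m) zero    = here refl
∈-allFin' (suc m) (suc x) = there (∈-map⁺ suc (∈-allFin' m x))

hom-resp : ∀ (A B : Digraph) (f g : V A → V B) → (∀ x → f x ≡ g x) → IsHom A B f → IsHom A B g
hom-resp A B f g e hf v w a = subst₂ (Arc B) (e v) (e w) (hf v w a)

star? : (G : Digraph) (v w : V G) → Dec (ArcStar G v w)
star? G v w = (arc G v w ≟B true) ×-dec ¬? (v ≟F w)

collapses-arc : ∀ (G H : Digraph) h → IsHom G H h → ¬ IsStrict G H h →
  ∃₂ λ v w → ArcStar G v w × h v ≡ h w
collapses-arc G H h hh nst
  with ¬∀⟶∃¬ _ (λ v → ∀ w → ArcStar G v w → ArcStar H (h v) (h w))
         (λ v → all? λ w → star? G v w →-dec star? H (h v) (h w)) (λ hs → nst (hh , hs))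
... | v , ¬Pv
  with ¬∀⟶∃¬ _ (λ w → ArcStar G v w → ArcStar H (h v) (h w))
         (λ w → star? G v w →-dec star? H (h v) (h w)) ¬Pv
... | w , ¬Pvw with star? G v w | h v ≟F h w
... | yes avw | yes e  = v , w , avw , e
... | yes avw | no ne  = ⊥-elim (¬Pvw (λ _ → hh v w (proj₁ avw) , ne))
... | no ¬avw | _      = ⊥-elim (¬Pvw (λ a → ⊥-elim (¬avw a)))

Middle : (T : Digraph) → V T → V T → V T → Set
Middle T a b x = Arc T a x × Arc T x b

middle? : (T : Digraph) (a b x : V T) → Dec (Middle T a b x)
middle? T a b x = (arc T a x ≟B true) ×-dec (arc T x b ≟B true)

#Middle : (T : Digraph) → V T → V T → ℕ
#Middle T a b = count (middle? T a b)

-- In a reflexive digraph both ends of a proper arc are middle vertices.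
#Middle-reflexive : ∀ T → Reflexive T → ∀ {a b} → ArcStar T a b → 2 ≤ #Middle T a b
#Middle-reflexive T rT (ab , a≢b) = count-≥2 (middle? T _ _) a≢b (rT _ , ab) (ab , rT _)

-- In an acyclic digraph only a itself lies between a and a.
#Middle-loop : ∀ T → Acyclic T → ∀ a → #Middle T a a ≤ 1
#Middle-loop T acT a = count-≤1 (middle? T a a) a only
  where
  only : ∀ x → Middle T a a x → x ≡ a
  only x (ax , xa) with x ≟F a
  ... | yes e  = e
  ... | no x≢a = ⊥-elim (acT a 1 (step (ax , λ e → x≢a (sym e)) (step (xa , x≢a) here)))

-- If T* = T_×, only the ends of a proper arc lie between them.
#Middle-transitive-reduction : ∀ T → StarIsTimes T → ∀ {a b} → ArcStar T a b → #Middle T a b ≤ 2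
#Middle-transitive-reduction T tT {a} {b} ab = count-≤2 (middle? T a b) a b only
  where
  only : ∀ x → Middle T a b x → x ≡ a ⊎ x ≡ b
  only x (ax , xb) with x ≟F a | x ≟F b
  ... | yes e  | _      = inj₁ e
  ... | no _   | yes e  = inj₂ e
  ... | no x≢a | no x≢b = ⊥-elim (proj₂ (Equivalence.to (tT a b) ab) 0
                                   (step (ax , λ e → x≢a (sym e)) (step (xb , x≢b) here)))

#Middle-≤2 : ∀ T → Acyclic T → StarIsTimes T → ∀ {a b} → Arc T a b → #Middle T a b ≤ 2
#Middle-≤2 T acT tT {a} {b} ab with a ≟F b
... | yes refl = ≤-trans (#Middle-loop T acT a) (s≤s z≤n)
... | no a≢b   = #Middle-transitive-reduction T tT (ab , a≢b)

-- The blow-up G⁽ⁿ⁾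

module BlowUp (G : Digraph) (n : ℕ) where

  k : ℕ
  k = suc (size G)

  properArc? : (p : V G × V G) → Dec (ArcStar G (proj₁ p) (proj₂ p))
  properArc? (v , w) = star? G v w

  arcList : List (V G × V G)
  arcList = filter properArc? (cartesianProduct (allFin' k) (allFin' k))

  m : ℕ
  m = length arcList

  src tgt : Fin m → V G
  src i = proj₁ (lookup arcList i)
  tgt i = proj₂ (lookup arcList i)

  arc-proper : ∀ i → ArcStar G (src i) (tgt i)
  arc-proper i = proj₂ (∈-filter⁻ properArc? {xs = cartesianProduct (allFin' k) (allFin' k)} (∈-lookup i))

  arc-index : ∀ v w → ArcStar G v w → ∃ λ i → src i ≡ v × tgt i ≡ w
  arc-index v w a = index mem , cong proj₁ (sym e) , cong proj₂ (sym e)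
    where
    mem : (v , w) ∈ arcList
    mem = ∈-filter⁺ properArc? (∈-cartesianProduct⁺ (∈-allFin' k v) (∈-allFin' k w)) a
    e : (v , w) ≡ lookup arcList (index mem)
    e = lookup-index mem

  -- c = n·m new vertices; new vertex j sits on the arc copyOf n j.
  c : ℕ
  c = n * m

  blowArc : V G ⊎ Fin c → V G ⊎ Fin c → Bool
  blowArc (inj₁ u) (inj₁ v) = arc G u v
  blowArc (inj₁ u) (inj₂ j) = does (u ≟F src (copyOf n j))
  blowArc (inj₂ j) (inj₁ v) = does (v ≟F tgt (copyOf n j))
  blowArc (inj₂ _) (inj₂ _) = false

  Gⁿ : Digraph
  Gⁿ = record { size = size G + c ; arc = λ a b → blowArc (splitAt k a) (splitAt k b) }

  -- Acyclicity: project G⁽ⁿ⁾ onto G, sending a new vertex to the source of its arc.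
  -- A proper arc either projects to a proper arc of G or goes old → new and projects
  -- to a single vertex; so a closed walk projects to a closed walk of G unless it
  -- consists of one old → new arc, which cannot be closed.

  IsOld IsNew : V G ⊎ Fin c → Set
  IsOld (inj₁ _) = ⊤
  IsOld (inj₂ _) = ⊥
  IsNew (inj₁ _) = ⊥
  IsNew (inj₂ _) = ⊤

  old-not-new : ∀ x → IsOld x → IsNew x → ⊥
  old-not-new (inj₁ _) _ ()
  old-not-new (inj₂ _) ()

  project′ : V G ⊎ Fin c → V G
  project′ = [ (λ u → u) , (λ j → src (copyOf n j)) ]′

  project : V Gⁿ → V G
  project a = project′ (splitAt k a)

  project-arc : ∀ x y → blowArc x y ≡ true → x ≢ y →
    ArcStar G (project′ x) (project′ y) ⊎ (project′ x ≡ project′ y × IsOld x × IsNew y)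
  project-arc (inj₁ u) (inj₁ v) p ne = inj₁ (p , λ e → ne (cong inj₁ e))
  project-arc (inj₁ u) (inj₂ j) p ne with u ≟F src (copyOf n j) | p
  ... | yes e | _  = inj₂ (e , tt , tt)
  ... | no _  | ()
  project-arc (inj₂ j) (inj₁ v) p ne with v ≟F tgt (copyOf n j) | p
  ... | yes refl | _ = inj₁ (arc-proper (copyOf n j))
  ... | no _     | ()
  project-arc (inj₂ _) (inj₂ _) () ne

  splitAt-injective : ∀ {a b : V Gⁿ} → splitAt k a ≡ splitAt k b → a ≡ b
  splitAt-injective {a} {b} e =
    trans (sym (join-splitAt k c a)) (trans (cong (join k c) e) (join-splitAt k c b))

  project-walk : ∀ {a b len} → Walk Gⁿ a b len → Σ ℕ λ len′ → Walk G (project a) (project b) len′ ×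
    (len′ ≡ 0 → (len ≡ 0 × a ≡ b) ⊎ (IsOld (splitAt k a) × IsNew (splitAt k b)))
  project-walk here = 0 , here , λ _ → inj₁ (refl , refl)
  project-walk {a} {b} (step {v = a′} s w)
    with project-walk w | project-arc (splitAt k a) (splitAt k a′) (proj₁ s) (λ e → proj₂ s (splitAt-injective e))
  ... | len′ , W , trivial | inj₁ s′ = suc len′ , step s′ W , λ ()
  ... | len′ , W , trivial | inj₂ (e , old-a , new-a′) =
    len′ , subst (λ z → Walk G z (project b) len′) (sym e) W , old-to-new
    where
    old-to-new : len′ ≡ 0 → _
    old-to-new len′≡0 with trivial len′≡0
    ... | inj₁ (_ , refl)  = inj₂ (old-a , new-a′)
    ... | inj₂ (old-a′ , _) = ⊥-elim (old-not-new (splitAt k a′) old-a′ new-a′)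

  acyclic-Gⁿ : Acyclic G → Acyclic Gⁿ
  acyclic-Gⁿ acG v len W with project-walk W
  ... | suc len′ , W′ , _ = acG (project v) len′ W′
  ... | zero , _ , trivial with trivial refl
  ... | inj₁ (() , _)
  ... | inj₂ (old , new) = old-not-new (splitAt k v) old new

  -- Homomorphisms G⁽ⁿ⁾ → T are pairs (h, t) with h : G → T a homomorphism and
  -- t(j) a middle vertex of h(arc j) for each new vertex j.
  module Target (T : Digraph) where

    B : ℕ
    B = suc (size T)

    K : (V G → V T) → Fin m → ℕ
    K h i = #Middle T (h (src i)) (h (tgt i))

    glue-old : ∀ (h : V G → V T) (t : Fin c → V T) u → glue {k} {c} h t (u ↑ˡ c) ≡ h u
    glue-old h t u = cong [ h , t ]′ (splitAt-↑ˡ k u c)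

    glue-new : ∀ (h : V G → V T) (t : Fin c → V T) j → glue {k} {c} h t (k ↑ʳ j) ≡ t j
    glue-new h t j = cong [ h , t ]′ (splitAt-↑ʳ k c j)

    ≟-refl : ∀ (x : V G) → does (x ≟F x) ≡ true
    ≟-refl x with x ≟F x
    ... | yes _ = refl
    ... | no ne = ⊥-elim (ne refl)

    restrict-hom : ∀ h t → IsHom Gⁿ T (glue h t) → IsHom G T h
    restrict-hom h t hg u v a = subst₂ (Arc T) (glue-old h t u) (glue-old h t v)
      (hg (u ↑ˡ c) (v ↑ˡ c) (trans (cong₂ blowArc (splitAt-↑ˡ k u c) (splitAt-↑ˡ k v c)) a))

    restrict-middle : ∀ h t → IsHom Gⁿ T (glue h t) → ∀ j →
      Middle T (h (src (copyOf n j))) (h (tgt (copyOf n j))) (t j)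
    restrict-middle h t hg j =
      subst₂ (Arc T) (glue-old h t s) (glue-new h t j)
        (hg (s ↑ˡ c) (k ↑ʳ j) (trans (cong₂ blowArc (splitAt-↑ˡ k s c) (splitAt-↑ʳ k c j)) (≟-refl s))) ,
      subst₂ (Arc T) (glue-new h t j) (glue-old h t w)
        (hg (k ↑ʳ j) (w ↑ˡ c) (trans (cong₂ blowArc (splitAt-↑ʳ k c j) (splitAt-↑ˡ k w c)) (≟-refl w)))
      where
      s = src (copyOf n j)
      w = tgt (copyOf n j)

    glue-hom : ∀ h t → IsHom G T h → (∀ j → Middle T (h (src (copyOf n j))) (h (tgt (copyOf n j))) (t j)) →
      IsHom Gⁿ T (glue h t)
    glue-hom h t hh mid a b p = on-parts (splitAt k a) (splitAt k b) p
      where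
      on-parts : ∀ x y → blowArc x y ≡ true → Arc T ([ h , t ]′ x) ([ h , t ]′ y)
      on-parts (inj₁ u) (inj₁ v) p = hh u v p
      on-parts (inj₁ u) (inj₂ j) p with u ≟F src (copyOf n j)
      ... | yes refl = proj₁ (mid j)
      on-parts (inj₂ j) (inj₁ v) p with v ≟F tgt (copyOf n j)
      ... | yes refl = proj₂ (mid j)
      on-parts (inj₂ _) (inj₂ _) ()

    extensions : ∀ h → Σl (allMaps c B) (λ t → ind (isHom? Gⁿ T (glue h t)))
                         ≡ ind (isHom? G T h) * Πf m (K h) ^ n
    extensions h with isHom? G T h
    ... | no ¬h = Σl-zero (allMaps c B) (λ t → ind-no (isHom? Gⁿ T (glue h t)) (λ hg → ¬h (restrict-hom h t hg)))
    ... | yes hh = begin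
        Σl (allMaps c B) (λ t → ind (isHom? Gⁿ T (glue h t)))
          ≡⟨ Σl-cong (allMaps c B) (λ t → Πf-ind c (λ j → middle? T _ _ (t j)) (isHom? Gⁿ T (glue h t))
               (restrict-middle h t) (glue-hom h t hh)) ⟩
        Σl (allMaps c B) (λ t → Πf c (λ j → ind (middle? T (h (src (copyOf n j))) (h (tgt (copyOf n j))) (t j))))
          ≡⟨ Σ-maps-Π c B (λ j x → ind (middle? T (h (src (copyOf n j))) (h (tgt (copyOf n j))) x)) ⟩
        Πf c (λ j → K h (copyOf n j))
          ≡⟨ Πf-copies n m (K h) ⟩
        Πf m (K h) ^ n
          ≡⟨ sym (*-identityˡ _) ⟩
        1 * Πf m (K h) ^ n ∎
      where open ≡-Reasoning

    #Hom-Gⁿ : #Hom Gⁿ T ≡ Σl (allMaps k B) (λ h → ind (isHom? G T h) * Πf m (K h) ^ n)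
    #Hom-Gⁿ = begin
        #Hom Gⁿ T
          ≡⟨ length-filter (isHom? Gⁿ T) (allMaps (k + c) B) ⟩
        Σl (allMaps (k + c) B) (λ g → ind (isHom? Gⁿ T g))
          ≡⟨ Σ-maps-split k c B (λ g → ind (isHom? Gⁿ T g)) respects ⟩
        Σl (allMaps c B) (λ t → Σl (allMaps k B) (λ h → ind (isHom? Gⁿ T (glue h t))))
          ≡⟨ sym (Σl-swap (allMaps k B) (allMaps c B) _) ⟩
        Σl (allMaps k B) (λ h → Σl (allMaps c B) (λ t → ind (isHom? Gⁿ T (glue h t))))
          ≡⟨ Σl-cong (allMaps k B) extensions ⟩
        Σl (allMaps k B) (λ h → ind (isHom? G T h) * Πf m (K h) ^ n) ∎
      where
      open ≡-Reasoning
      respects : Respects (λ g → ind (isHom? Gⁿ T g))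
      respects f g e = ind-cong (hom-resp Gⁿ T f g e) (hom-resp Gⁿ T g f (λ x → sym (e x))) _ _

  X : ℕ
  X = (2 ^ m) ^ n

  -- Lower bound for a reflexive target: each strict h contributes at least X.
  #Hom-Gⁿ-lower : ∀ R → Reflexive R → #Strict G R * X ≤ #Hom Gⁿ R
  #Hom-Gⁿ-lower R rR = begin
      #Strict G R * X
        ≡⟨ cong (_* X) (length-filter (isStrict? G R) (allMaps k BR)) ⟩
      Σl (allMaps k BR) (λ h → ind (isStrict? G R h)) * X
        ≡⟨ sym (Σl-*ʳ (allMaps k BR) X _) ⟩
      Σl (allMaps k BR) (λ h → ind (isStrict? G R h) * X)
        ≤⟨ Σl-mono (allMaps k BR) per-map ⟩
      Σl (allMaps k BR) (λ h → ind (isHom? G R h) * Πf m (K h) ^ n)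
        ≡⟨ sym #Hom-Gⁿ ⟩
      #Hom Gⁿ R ∎
    where
    open Target R renaming (B to BR)
    open ≤-Reasoning hiding (IsStrict)
    per-map : ∀ h → ind (isStrict? G R h) * X ≤ ind (isHom? G R h) * Πf m (K h) ^ n
    per-map h with isStrict? G R h
    ... | no _ = z≤n
    ... | yes (hh , hs) rewrite ind-yes (isHom? G R h) hh =
      *-monoʳ-≤ 1 (^-monoˡ-≤ n (Πf-≥2 m (λ i → #Middle-reflexive R rR (hs _ _ (arc-proper i)))))

  -- Upper bound for an acyclic target S with S* = S_×: a strict h contributes at
  -- most X, a non-strict homomorphism at most X / 2ⁿ.
  #Hom-Gⁿ-upper : ∀ S → Acyclic S → StarIsTimes S →
    2 ^ n * #Hom Gⁿ S ≤ #Strict G S * (2 ^ n * X) + #Hom G S * X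
  #Hom-Gⁿ-upper S acS tS = begin
      2 ^ n * #Hom Gⁿ S
        ≡⟨ cong (2 ^ n *_) #Hom-Gⁿ ⟩
      2 ^ n * Σl (allMaps k BS) weight
        ≡⟨ sym (Σl-*ˡ (allMaps k BS) (2 ^ n) weight) ⟩
      Σl (allMaps k BS) (λ h → 2 ^ n * weight h)
        ≤⟨ Σl-mono (allMaps k BS) per-map ⟩
      Σl (allMaps k BS) (λ h → ind (isStrict? G S h) * (2 ^ n * X) + ind (isHom? G S h) * X)
        ≡⟨ Σl-+ (allMaps k BS) _ _ ⟩
      Σl (allMaps k BS) (λ h → ind (isStrict? G S h) * (2 ^ n * X)) + Σl (allMaps k BS) (λ h → ind (isHom? G S h) * X)
        ≡⟨ cong₂ _+_ (trans (Σl-*ʳ (allMaps k BS) (2 ^ n * X) _) (cong (_* (2 ^ n * X)) (sym (length-filter (isStrict? G S) (allMaps k BS)))))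
                     (trans (Σl-*ʳ (allMaps k BS) X _) (cong (_* X) (sym (length-filter (isHom? G S) (allMaps k BS))))) ⟩
      #Strict G S * (2 ^ n * X) + #Hom G S * X ∎
    where
    open Target S renaming (B to BS)
    open ≤-Reasoning hiding (IsStrict)
    weight : (V G → V S) → ℕ
    weight h = ind (isHom? G S h) * Πf m (K h) ^ n

    K-≤2 : ∀ h → IsHom G S h → ∀ i → K h i ≤ 2
    K-≤2 h hh i = #Middle-≤2 S acS tS (hh _ _ (proj₁ (arc-proper i)))

    hom-bound : ∀ h → IsHom G S h → Πf m (K h) ^ n ≤ X
    hom-bound h hh = ^-monoˡ-≤ n (Πf-≤2 m (K-≤2 h hh))

    nonstrict-bound : ∀ h → IsHom G S h → ¬ IsStrict G S h → 2 ^ n * Πf m (K h) ^ n ≤ X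
    nonstrict-bound h hh nst with collapses-arc G S h hh nst
    ... | v , w , vw , hv≡hw with arc-index v w vw
    ... | i , refl , refl =
      ≤-trans (≤-reflexive (sym (*-^-distrib 2 (Πf m (K h)) n)))
        (^-monoˡ-≤ n (Πf-≤2-defect m (K-≤2 h hh) i
          (≤-trans (≤-reflexive (cong (#Middle S (h v)) (sym hv≡hw))) (#Middle-loop S acS (h v)))))

    per-map : ∀ h → 2 ^ n * weight h ≤ ind (isStrict? G S h) * (2 ^ n * X) + ind (isHom? G S h) * X
    per-map h with isHom? G S h | isStrict? G S h
    ... | no _   | _ = ≤-trans (≤-reflexive (*-zeroʳ (2 ^ n))) z≤n
    ... | yes hh | yes _ rewrite *-identityˡ (Πf m (K h) ^ n) | *-identityˡ X | +-identityʳ (2 ^ n * X) =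
      ≤-trans (*-monoʳ-≤ (2 ^ n) (hom-bound h hh)) (m≤m+n _ _)
    ... | yes hh | no nst rewrite *-identityˡ (Πf m (K h) ^ n) | *-identityˡ X = nonstrict-bound h hh nst

-- With n = #𝓗(G,S), the hypothesis applied to the acyclic blow-up G⁽ⁿ⁾ sits
-- between the two bounds, and the squeeze gives #𝓢(G,R) ≤ #𝓢(G,S).

theorem5 : (R S : Digraph)
    → Acyclic R → Reflexive R → StarIsTimes R
    → Acyclic S → Reflexive S → StarIsTimes S
    → ((G : Digraph) → Acyclic G → #Hom G R ≤ #Hom G S)
    → (G : Digraph) → Acyclic G → ∃ (IsStrict G S)
    → #Strict G R ≤ #Strict G S
theorem5 R S _ rR _ acS _ tS hom-dominated G acG _ =
  squeeze (#Hom-Gⁿ-lower R rR) (hom-dominated Gⁿ (acyclic-Gⁿ acG)) (#Hom-Gⁿ-upper S acS tS)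
          (n<2^n (#Hom G S)) X≥1
  where
  open BlowUp G (#Hom G S)
  X≥1 : 1 ≤ X
  X≥1 = ≤-trans (≤-reflexive (sym (^-zeroˡ (#Hom G S)))) (^-monoˡ-≤ (#Hom G S) (m^n>0 2 m))
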